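{- For a graph $G=(V,E)$: $\text{ffn}(G)=1$ if and only if $|E|=0$; and $\text{ffn}(G)=2$ if and only if $|E|>0$ and every connected component of $G$ is a caterpillar graph, i.e., a tree in which all nodes are within distance $1$ of a central path.
   Context: All graphs are finite, simple and undirected. For a graph $G=(V,E)$ and $W\subseteq V$, $N(W)$ is the set of nodes in $V\setminus W$ adjacent to at least one node of $W$. For $m\in\mathbb{N}_{>0}$, an $m$-strategy of length $T$ is a sequence $(F_1,\dots,F_T)$ of subsets of $V$ with $|F_i|\le m$. Its burning sets are $B_0=V$ and $B_t=(B_{t-1}\setminus F_t)\cup N(B_{t-1}\setminus F_t)$ for $t\ge1$, where $F_t=\emptyset$ for $t>T$. The strategy is winning if $B_T=\emptyset$. The firefighter number $\text{ffn}(G)$ is the smallest $m$ for which a winning $m$-strategy for $G$ exists. -}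

module Defs where

open import Data.Nat using (ℕ; zero; suc; _≤_; _<_)
open import Data.Fin using (Fin) renaming (zero to fzero; suc to fsuc)
open import Data.Bool using (Bool; true; false; _∧_; _∨_; not)
open import Data.Fin.Subset using (Subset; ∣_∣; ⊥; ⊤; _∪_; _─_)
open import Data.Vec using (tabulate; lookup)
open import Data.List using (List; []; _∷_; _++_; [_]; length)
open import Data.List.Relation.Unary.All using (All)
open import Data.List.Relation.Unary.Any using (Any)
open import Data.List.Relation.Unary.Linked using (Linked)
open import Data.List.Relation.Unary.Unique.Propositional using (Unique)
open import Data.Product using (_×_; Σ; ∃; ∃-syntax)
open import Data.Sum using (_⊎_)
open import Relation.Nullary using (¬_)
open import Relation.Binary.PropositionalEquality using (_≡_)

record Graph (n : ℕ) : Set where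
  field
    adj    : Fin n → Fin n → Bool
    sym    : ∀ u v → adj u v ≡ adj v u
    irrefl : ∀ v → adj v v ≡ false
open Graph public

module _ {n : ℕ} (G : Graph n) where

  Adj : Fin n → Fin n → Set
  Adj u v = adj G u v ≡ true

  NoEdges : Set
  NoEdges = ∀ u v → adj G u v ≡ false

  HasEdge : Set
  HasEdge = ∃[ u ] ∃[ v ] Adj u v

  N : Subset n → Subset n
  N W = tabulate (λ v → not (lookup W v) ∧ anyFin (λ u → lookup W u ∧ adj G u v))
    where
      anyFin : ∀ {k} → (Fin k → Bool) → Bool
      anyFin {zero}  f = false
      anyFin {suc k} f = f fzero ∨ anyFin (λ i → f (fsuc i))

  step : Subset n → Subset n → Subset n
  step B F = (B ─ F) ∪ N (B ─ F)

  burn : Subset n → List (Subset n) → Subset n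
  burn B []       = B
  burn B (F ∷ Fs) = burn (step B F) Fs

  WinningStrategy : ℕ → List (Subset n) → Set
  WinningStrategy m Fs = All (λ F → ∣ F ∣ ≤ m) Fs × burn ⊤ Fs ≡ ⊥

  Winnable : ℕ → Set
  Winnable m = ∃[ Fs ] WinningStrategy m Fs

  FFN≡ : ℕ → Set
  FFN≡ m = 0 < m × Winnable m × (∀ k → 0 < k → k < m → ¬ Winnable k)

  data Reach (u : Fin n) : Fin n → Set where
    here  : Reach u u
    there : ∀ {v w} → Reach u v → Adj v w → Reach u w

  IsPath : List (Fin n) → Set
  IsPath xs = Unique xs × Linked Adj xs

  IsCycle : Fin n → List (Fin n) → Set
  IsCycle x ys = 2 ≤ length ys × Unique (x ∷ ys) × Linked Adj (x ∷ ys ++ [ x ])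

  -- the component of v is a tree: it is connected by definition, and acyclic
  ComponentIsTree : Fin n → Set
  ComponentIsTree v = ∀ x ys → IsCycle x ys → ¬ All (Reach v) (x ∷ ys)

  ComponentIsCaterpillar : Fin n → Set
  ComponentIsCaterpillar v =
    ComponentIsTree v ×
    ∃[ P ] (IsPath P × All (Reach v) P ×
            (∀ w → Reach v w → Any (λ p → p ≡ w ⊎ Adj p w) P))

module Submission where

-- Lower bounds come from invariants of the burning set. Against one firefighter the two ends of
-- an edge keep each other alight; against two, so does every node of a cycle with its two cycle
-- neighbours, and a spider (three legs of length two at a body) always keeps its body and either
-- two whole legs, or all three legs and one whole leg, burning. Hence if two firefighters win,
-- every component is a spider-free tree, and a path of inner nodes grown greedily at both ends is
-- a spine: an inner neighbour of an interior path node that lies off the path would be the third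
-- leg of a spider. Conversely a caterpillar is extinguished along its spine: while a spine node p
-- is guarded every node is protected once, which puts out the leaves of p, and then p is guarded
-- together with its successor.

open import Defs
open import Data.Nat using (ℕ; zero; suc; _+_; _≤_; _<_; z≤n; s≤s)
open import Data.Nat.Properties
  using (≤-trans; ≤-reflexive; +-suc; +-identityʳ; m≤n+m; m≤n⇒m≤1+n; <-irrefl; <-≤-trans; n<1+n)
open import Data.Fin using (Fin; zero; suc)
open import Data.Fin.Properties using (any?) renaming (_≟_ to _≟ᶠ_)
open import Data.Bool using (Bool; true; false; _∧_; _∨_; not)
open import Data.Bool.Properties as Bool using (∨-zeroʳ; ¬-not)
open import Data.Fin.Subset as Sub
  using (Subset; ∣_∣; ⁅_⁆; _─_; inside; outside)
  renaming (_∈_ to _∈ₛ_; _∉_ to _∉ₛ_; ⊤ to V; ⊥ to ∅)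
open import Data.Fin.Subset.Properties
  using (x∈p⇒∣p-x∣<∣p∣; x∈p∧x≢y⇒x∈p-y; x∈p∧x∉q⇒x∈p─q; p─q⊆p; x∈p∪q⁻; x∈p∪q⁺;
         x∈⁅x⁆; ∣⁅x⁆∣≡1; ∈⊤; ∉⊥; ∣⊤∣≡n; Empty-unique)
  renaming (_∈?_ to _∈ₛ?_)
open import Data.Vec as Vec using ([]; _∷_; lookup)
open import Data.Vec.Properties using (lookup∘tabulate; []=⇒lookup; lookup⇒[]=)
open import Data.List
  using (List; []; _∷_; _++_; [_]; _∷ʳ_; length; reverse; map; concatMap; allFin; initLast; _∷ʳ′_)
open import Data.List.Properties using (unfold-reverse; reverse-++; reverse-injective; ++-assoc; ++-conicalʳ)
open import Data.List.Relation.Unary.All using (All; []; _∷_)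
import Data.List.Relation.Unary.All as All
import Data.List.Relation.Unary.All.Properties as All
open import Data.List.Relation.Unary.All.Properties using (¬All⇒Any¬; ¬Any⇒All¬)
open import Data.List.Relation.Unary.Any using (Any; here; there)
import Data.List.Relation.Unary.Any as Any
import Data.List.Relation.Unary.Any.Properties as Any
open import Data.List.Relation.Unary.Linked using (Linked; []; [-]; _∷_)
import Data.List.Relation.Unary.Linked as Linked
import Data.List.Relation.Unary.Unique.Propositional.Properties as Unique
open import Data.List.Relation.Unary.AllPairs using ([]; _∷_)
open import Data.List.Membership.Propositional using (_∈_; _∉_; find)
open import Data.List.Membership.Propositional.Properties using (∈-++⁻; ∈-++⁺ˡ; ∈-++⁺ʳ; ∈-∃++; ∈-allFin)
open import Data.List.Relation.Unary.Unique.Propositional using (Unique)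
open import Data.Product using (_×_; _,_; ∃-syntax; proj₁; proj₂)
open import Data.Sum as Sum using (_⊎_; inj₁; inj₂; [_,_]′)
open import Data.Empty using (⊥; ⊥-elim)
open import Data.Unit using (⊤; tt)
open import Function using (id; _∘_; case_of_)
open import Function.Bundles using (_⇔_; mk⇔)
open import Relation.Nullary using (¬_; Dec; yes; no)
open import Relation.Nullary.Decidable using (_×-dec_; ¬?)
open import Relation.Binary.PropositionalEquality
  using (_≡_; _≢_; refl; cong; cong₂; subst; trans; module ≡-Reasoning) renaming (sym to ≡-sym)

private
  variable
    n : ℕ

module _ {A : Set} where

  Unique-++⁻ˡ : ∀ (xs : List A) {ys} → Unique (xs ++ ys) → Unique xs
  Unique-++⁻ˡ []       _            = []
  Unique-++⁻ˡ (x ∷ xs) (x∉xs ∷ uxs) = All.++⁻ˡ xs x∉xs ∷ Unique-++⁻ˡ xs uxs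

  Unique-++⁻ʳ : ∀ (xs : List A) {ys} → Unique (xs ++ ys) → Unique ys
  Unique-++⁻ʳ []       u         = u
  Unique-++⁻ʳ (x ∷ xs) (_ ∷ uxs) = Unique-++⁻ʳ xs uxs

  Unique-reverse : ∀ {xs : List A} → Unique xs → Unique (reverse xs)
  Unique-reverse {[]}     []           = []
  Unique-reverse {x ∷ xs} (x∉xs ∷ uxs) rewrite unfold-reverse x xs =
    Unique.++⁺ (Unique-reverse uxs) ([] ∷ []) λ { (x∈ , here refl) → All.lookup x∉xs (Any.reverse⁻ x∈) refl }

  Unique-∷ʳ⁻ : ∀ (xs : List A) {x} → Unique (xs ∷ʳ x) → x ∉ xs
  Unique-∷ʳ⁻ (y ∷ xs) (y∉ ∷ _)   (here refl) = All.lookup y∉ (∈-++⁺ʳ xs (here refl)) refl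
  Unique-∷ʳ⁻ (y ∷ xs) (_ ∷ uxs) (there x∈) = Unique-∷ʳ⁻ xs uxs x∈

  All-reverse : ∀ {P : A → Set} {xs} → All P xs → All P (reverse xs)
  All-reverse pxs = All.tabulate (All.lookup pxs ∘ Any.reverse⁻)

  reverse-∷ : ∀ (x : A) xs → ∃[ h ] ∃[ t ] (reverse (x ∷ xs) ≡ h ∷ t)
  reverse-∷ x xs rewrite unfold-reverse x xs with reverse xs
  ... | []    = x , [] , refl
  ... | h ∷ t = h , t ∷ʳ x , refl

  ∈-∈-split : ∀ {a b : A} {xs} → a ∈ xs → b ∈ xs → a ≢ b →
              (∃[ P ] ∃[ L ] ∃[ R ] (xs ≡ P ++ a ∷ L ++ b ∷ R)) ⊎ (∃[ P ] ∃[ L ] ∃[ R ] (xs ≡ P ++ b ∷ L ++ a ∷ R))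
  ∈-∈-split {a} {b} a∈xs b∈xs a≢b with P , R , refl ← ∈-∃++ a∈xs with ∈-++⁻ P b∈xs
  ... | inj₁ b∈P with P₁ , P₂ , refl ← ∈-∃++ b∈P = inj₂ (P₁ , P₂ , R , ++-assoc P₁ (b ∷ P₂) (a ∷ R))
  ... | inj₂ (here b≡a)  = ⊥-elim (a≢b (≡-sym b≡a))
  ... | inj₂ (there b∈R) with L , R' , refl ← ∈-∃++ b∈R = inj₁ (P , L , R' , refl)

  2≤length : ∀ (L : List A) {b} E → L ++ E ≢ [] → 2 ≤ length (L ++ b ∷ E)
  2≤length []           []      L++E≢[] = ⊥-elim (L++E≢[] refl)
  2≤length []           (_ ∷ _) _       = s≤s (s≤s z≤n)
  2≤length (_ ∷ [])     _       _       = s≤s (s≤s z≤n)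
  2≤length (_ ∷ _ ∷ _)  _       _       = s≤s (s≤s z≤n)

  module _ {R : A → A → Set} where

    Linked-glue : ∀ xs {b ys} → Linked R (xs ∷ʳ b) → Linked R (b ∷ ys) → Linked R (xs ++ b ∷ ys)
    Linked-glue []            _         lk = lk
    Linked-glue (x ∷ [])      (xb ∷ _)  lk = xb ∷ lk
    Linked-glue (x ∷ x' ∷ xs) (xx' ∷ l) lk = xx' ∷ Linked-glue (x' ∷ xs) l lk

    Linked-++⁻ˡ : ∀ xs {ys} → Linked R (xs ++ ys) → Linked R xs
    Linked-++⁻ˡ []           _         = []
    Linked-++⁻ˡ (x ∷ [])     _         = [-]
    Linked-++⁻ˡ (x ∷ y ∷ xs) (xy ∷ lk) = xy ∷ Linked-++⁻ˡ (y ∷ xs) lk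

    Linked-++⁻ʳ : ∀ xs {ys} → Linked R (xs ++ ys) → Linked R ys
    Linked-++⁻ʳ []           lk        = lk
    Linked-++⁻ʳ (x ∷ [])     lk        = Linked.tail lk
    Linked-++⁻ʳ (x ∷ y ∷ xs) (_ ∷ lk)  = Linked-++⁻ʳ (y ∷ xs) lk

    Linked-reverse : (∀ {x y} → R x y → R y x) → ∀ {xs} → Linked R xs → Linked R (reverse xs)
    Linked-reverse R-sym {[]}         []        = []
    Linked-reverse R-sym {x ∷ []}     [-]       = [-]
    Linked-reverse R-sym {x ∷ y ∷ zs} (xy ∷ lk) with Linked-reverse R-sym lk
    ... | lk-rev rewrite unfold-reverse x (y ∷ zs) | unfold-reverse y zs | ++-assoc (reverse zs) [ y ] [ x ] =
      Linked-glue (reverse zs) lk-rev (R-sym xy ∷ [-])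

lookup-∉ : ∀ {x} (p : Subset n) → x ∉ₛ p → lookup p x ≡ false
lookup-∉ {x = x} p x∉p with lookup p x in eq
... | true  = ⊥-elim (x∉p (lookup⇒[]= x p eq))
... | false = refl

x∈p─q⁻ : ∀ {x} (p q : Subset n) → x ∈ₛ p ─ q → x ∈ₛ p × x ∉ₛ q
x∈p─q⁻ p q x∈ = p─q⊆p p q x∈ , x∉q p q x∈
  where
  x∉q : ∀ {n x} (p q : Subset n) → x ∈ₛ p ─ q → x ∉ₛ q
  x∉q (_ ∷ p) (inside ∷ q) (Vec.there x∈) (Vec.there x∈q) = x∉q p q x∈ x∈q
  x∉q (_ ∷ p) (outside ∷ q) (Vec.there x∈) (Vec.there x∈q) = x∉q p q x∈ x∈q

∣p∪q∣≤∣p∣+∣q∣ : ∀ (p q : Subset n) → ∣ p Sub.∪ q ∣ ≤ ∣ p ∣ + ∣ q ∣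
∣p∪q∣≤∣p∣+∣q∣ []            []            = z≤n
∣p∪q∣≤∣p∣+∣q∣ (outside ∷ p) (outside ∷ q) = ∣p∪q∣≤∣p∣+∣q∣ p q
∣p∪q∣≤∣p∣+∣q∣ (outside ∷ p) (inside ∷ q)  =
  ≤-trans (s≤s (∣p∪q∣≤∣p∣+∣q∣ p q)) (≤-reflexive (≡-sym (+-suc ∣ p ∣ ∣ q ∣)))
∣p∪q∣≤∣p∣+∣q∣ (inside ∷ p)  (outside ∷ q) = s≤s (∣p∪q∣≤∣p∣+∣q∣ p q)
∣p∪q∣≤∣p∣+∣q∣ (inside ∷ p)  (inside ∷ q)  =
  s≤s (≤-trans (m≤n⇒m≤1+n (∣p∪q∣≤∣p∣+∣q∣ p q)) (≤-reflexive (≡-sym (+-suc ∣ p ∣ ∣ q ∣))))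

Unique⇒length≤∣∣ : ∀ {p : Subset n} {xs} → Unique xs → All (_∈ₛ p) xs → length xs ≤ ∣ p ∣
Unique⇒length≤∣∣ []           []            = z≤n
Unique⇒length≤∣∣ (x∉xs ∷ uxs) (x∈p ∷ xs⊆p) =
  ≤-trans (s≤s (Unique⇒length≤∣∣ uxs xs⊆p-x)) (x∈p⇒∣p-x∣<∣p∣ x∈p)
  where
  xs⊆p-x = All.zipWith (λ (x≢y , y∈p) → x∈p∧x≢y⇒x∈p-y y∈p (x≢y ∘ ≡-sym)) (x∉xs , xs⊆p)

pigeonhole : ∀ {p : Subset n} {xs} → Unique xs → ∣ p ∣ < length xs → ¬ All (_∈ₛ p) xs
pigeonhole uxs ∣p∣<len xs⊆p = <-irrefl refl (<-≤-trans ∣p∣<len (Unique⇒length≤∣∣ uxs xs⊆p))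

infix 4 _∈?_
_∈?_ : ∀ (x : Fin n) xs → Dec (x ∈ xs)
x ∈? xs = Any.any? (x ≟ᶠ_) xs

Unique⇒length≤n : ∀ {xs : List (Fin n)} → Unique xs → length xs ≤ n
Unique⇒length≤n {n} {xs} u = subst (length xs ≤_) (∣⊤∣≡n n) (Unique⇒length≤∣∣ u (All.universal (λ _ → ∈⊤) xs))

pair : Fin n → Fin n → Subset n
pair a b = ⁅ a ⁆ Sub.∪ ⁅ b ⁆

∣pair∣≤2 : ∀ (a b : Fin n) → ∣ pair a b ∣ ≤ 2
∣pair∣≤2 a b = subst (∣ pair a b ∣ ≤_) (cong₂ _+_ (∣⁅x⁆∣≡1 a) (∣⁅x⁆∣≡1 b)) (∣p∪q∣≤∣p∣+∣q∣ ⁅ a ⁆ ⁅ b ⁆)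

a∈pair : ∀ (a b : Fin n) → a ∈ₛ pair a b
a∈pair a b = x∈p∪q⁺ (inj₁ (x∈⁅x⁆ a))

b∈pair : ∀ (a b : Fin n) → b ∈ₛ pair a b
b∈pair a b = x∈p∪q⁺ (inj₂ (x∈⁅x⁆ b))

triple : ∀ {A : Set} → A → A → A → Fin 3 → A
triple a b d zero             = a
triple a b d (suc zero)       = b
triple a b d (suc (suc zero)) = d

triple-all : ∀ {A : Set} {P : A → Set} {a b d} → P a → P b → P d → ∀ i → P (triple a b d i)
triple-all pa pb pd zero             = pa
triple-all pa pb pd (suc zero)       = pb
triple-all pa pb pd (suc (suc zero)) = pd

triple-injective : ∀ {A : Set} {a b d : A} → a ≢ b → a ≢ d → b ≢ d →
                   ∀ {i j} → i ≢ j → triple a b d i ≢ triple a b d j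
triple-injective a≢b a≢d b≢d {zero}             {zero}             i≢j = ⊥-elim (i≢j refl)
triple-injective a≢b a≢d b≢d {zero}             {suc zero}         _   = a≢b
triple-injective a≢b a≢d b≢d {zero}             {suc (suc zero)}   _   = a≢d
triple-injective a≢b a≢d b≢d {suc zero}         {zero}             _   = a≢b ∘ ≡-sym
triple-injective a≢b a≢d b≢d {suc zero}         {suc zero}         i≢j = ⊥-elim (i≢j refl)
triple-injective a≢b a≢d b≢d {suc zero}         {suc (suc zero)}   _   = b≢d
triple-injective a≢b a≢d b≢d {suc (suc zero)}   {zero}             _   = a≢d ∘ ≡-sym
triple-injective a≢b a≢d b≢d {suc (suc zero)}   {suc zero}         _   = b≢d ∘ ≡-sym
triple-injective a≢b a≢d b≢d {suc (suc zero)}   {suc (suc zero)}   i≢j = ⊥-elim (i≢j refl)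

other-two : ∀ (i : Fin 3) → ∃[ j ] ∃[ k ] (i ≢ j × i ≢ k × j ≢ k)
other-two zero             = suc zero , suc (suc zero) , (λ ()) , (λ ()) , (λ ())
other-two (suc zero)       = zero , suc (suc zero) , (λ ()) , (λ ()) , (λ ())
other-two (suc (suc zero)) = zero , suc zero , (λ ()) , (λ ()) , (λ ())

∧≡true⁻ : ∀ a b → a ∧ b ≡ true → a ≡ true × b ≡ true
∧≡true⁻ true true refl = refl , refl

-- N tests "some node of W is adjacent to v" with a function local to Defs. At the centre of a
-- star graph whose centre has neighbourhood g, that test computes "some u ∈ W has g u".
star : ∀ {k} → (Fin k → Bool) → Graph (suc k)
star {k} g = record { adj = star-adj ; sym = star-sym ; irrefl = star-irrefl }
  where
  star-adj : Fin (suc k) → Fin (suc k) → Bool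
  star-adj zero    zero    = false
  star-adj zero    (suc j) = g j
  star-adj (suc i) zero    = g i
  star-adj (suc i) (suc j) = false
  star-sym : ∀ i j → star-adj i j ≡ star-adj j i
  star-sym zero    zero    = refl
  star-sym zero    (suc j) = refl
  star-sym (suc i) zero    = refl
  star-sym (suc i) (suc j) = refl
  star-irrefl : ∀ i → star-adj i i ≡ false
  star-irrefl zero    = refl
  star-irrefl (suc i) = refl

meets : ∀ {k} → Subset k → (Fin k → Bool) → Bool
meets W g = lookup (N (star g) (outside ∷ W)) zero

meets⁺ : ∀ {k} (W : Subset k) g {u} → u ∈ₛ W → g u ≡ true → meets W g ≡ true
meets⁺ (inside ∷ W) g Vec.here         gu rewrite gu = refl
meets⁺ (s ∷ W)      g (Vec.there u∈W) gu =
  trans (cong ((s ∧ g zero) ∨_) (meets⁺ W (g ∘ suc) u∈W gu)) (∨-zeroʳ _)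

meets⁻ : ∀ {k} (W : Subset k) g → meets W g ≡ true → ∃[ u ] (u ∈ₛ W × g u ≡ true)
meets⁻ (inside ∷ W) g eq with g zero in g0
... | true  = zero , Vec.here , g0
... | false = let u , u∈W , gu = meets⁻ W (g ∘ suc) eq in suc u , Vec.there u∈W , gu
meets⁻ (outside ∷ W) g eq = let u , u∈W , gu = meets⁻ W (g ∘ suc) eq in suc u , Vec.there u∈W , gu

module _ (G : Graph n) where

  Adj-sym : ∀ {u v} → Adj G u v → Adj G v u
  Adj-sym {u} {v} uv = trans (sym G v u) uv

  Adj⇒≢ : ∀ {u v} → Adj G u v → u ≢ v
  Adj⇒≢ {u} uu refl with trans (≡-sym uu) (irrefl G u)
  ... | ()

  Adj? : ∀ u v → Dec (Adj G u v)
  Adj? u v = adj G u v Bool.≟ true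

  edge-or-noEdges : HasEdge G ⊎ NoEdges G
  edge-or-noEdges with any? (λ u → any? (λ v → Adj? u v))
  ... | yes edge = inj₁ edge
  ... | no  none = inj₂ λ u v → ¬-not λ uv → none (u , v , uv)

  Reach-Linked : ∀ {v a xs} → Reach G v a → Linked (Adj G) (a ∷ xs) → All (Reach G v) (a ∷ xs)
  Reach-Linked v⇝a [-]       = v⇝a ∷ []
  Reach-Linked v⇝a (ab ∷ lk) = v⇝a ∷ Reach-Linked (there v⇝a ab) lk

  lookup-N : ∀ W v → lookup (N G W) v ≡ not (lookup W v) ∧ meets W (λ u → adj G u v)
  lookup-N W v = lookup∘tabulate _ v

  ∈N⁺ : ∀ {W u v} → v ∉ₛ W → u ∈ₛ W → Adj G u v → v ∈ₛ N G W
  ∈N⁺ {W} {u} {v} v∉W u∈W uv = lookup⇒[]= v (N G W) (begin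
    lookup (N G W) v                              ≡⟨ lookup-N W v ⟩
    not (lookup W v) ∧ meets W (λ u → adj G u v)
      ≡⟨ cong₂ (λ a b → not a ∧ b) (lookup-∉ W v∉W) (meets⁺ W _ u∈W uv) ⟩
    true                                          ∎)
    where open ≡-Reasoning

  ∈N⁻ : ∀ {W v} → v ∈ₛ N G W → ∃[ u ] (u ∈ₛ W × Adj G u v)
  ∈N⁻ {W} {v} v∈N =
    meets⁻ W _ (proj₂ (∧≡true⁻ (not (lookup W v)) _ (trans (≡-sym (lookup-N W v)) ([]=⇒lookup v∈N))))

  step-keeps : ∀ {B F x} → x ∈ₛ B ─ F → x ∈ₛ step G B F
  step-keeps x∈B─F = x∈p∪q⁺ (inj₁ x∈B─F)

  step-spreads : ∀ {B F x y} → y ∈ₛ B ─ F → Adj G y x → x ∈ₛ step G B F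
  step-spreads {B} {F} {x} y∈B─F yx with x ∈ₛ? B ─ F
  ... | yes x∈B─F = step-keeps x∈B─F
  ... | no  x∉B─F = x∈p∪q⁺ (inj₂ (∈N⁺ x∉B─F y∈B─F yx))

  ∈step⁻ : ∀ {B F x} → x ∈ₛ step G B F → x ∈ₛ B ─ F ⊎ ∃[ y ] (y ∈ₛ B ─ F × Adj G y x)
  ∈step⁻ {B} {F} x∈ with x∈p∪q⁻ (B ─ F) (N G (B ─ F)) x∈
  ... | inj₁ x∈B─F = inj₁ x∈B─F
  ... | inj₂ x∈N   = inj₂ (∈N⁻ x∈N)

  burn-++ : ∀ B Fs Gs → burn G B (Fs ++ Gs) ≡ burn G (burn G B Fs) Gs
  burn-++ B []       Gs = refl
  burn-++ B (F ∷ Fs) Gs = burn-++ (step G B F) Fs Gs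

  -- Lower bounds

  invariant⇒¬Winnable : ∀ {m} (I : Subset n → Set) → I V → ¬ I ∅ →
                        (∀ {B F} → ∣ F ∣ ≤ m → I B → I (step G B F)) → ¬ Winnable G m
  invariant⇒¬Winnable {m} I I-V ¬I-∅ I-step (Fs , small , burnt) = ¬I-∅ (subst I burnt (preserved small I-V))
    where
    preserved : ∀ {B Fs} → All (λ F → ∣ F ∣ ≤ m) Fs → I B → I (burn G B Fs)
    preserved []              I-B = I-B
    preserved (small ∷ smalls) I-B = preserved smalls (I-step small I-B)

  NeighboursIn : ℕ → List (Fin n) → Fin n → Set
  NeighboursIn m S x = ∃[ ys ] (length ys ≡ m × Unique ys × All (λ y → y ∈ S × Adj G x y) ys)

  Sustaining : ℕ → List (Fin n) → Set
  Sustaining m S = ∀ {x} → x ∈ S → NeighboursIn m S x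

  -- m firefighters cannot protect a node together with m of its neighbours.
  sustaining⇒¬Winnable : ∀ {m x S} → Sustaining m (x ∷ S) → ¬ Winnable G m
  sustaining⇒¬Winnable {m} {x} {S} sustaining =
    invariant⇒¬Winnable (λ B → All (_∈ₛ B) (x ∷ S)) (All.universal (λ _ → ∈⊤) _) (λ { (x∈∅ ∷ _) → ∉⊥ x∈∅ }) keeps
    where
    keeps : ∀ {B F} → ∣ F ∣ ≤ m → All (_∈ₛ B) (x ∷ S) → All (_∈ₛ step G B F) (x ∷ S)
    keeps {B} {F} ∣F∣≤m S⊆B = All.tabulate rekindled
      where
      rekindled : ∀ {z} → z ∈ x ∷ S → z ∈ₛ step G B F
      rekindled {z} z∈S with sustaining z∈S
      ... | ys , refl , uys , nbrs
        with ¬All⇒Any¬ (_∈ₛ? F) (z ∷ ys) (pigeonhole (All.map (Adj⇒≢ ∘ proj₂) nbrs ∷ uys) (s≤s ∣F∣≤m))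
      ... | here z∉F = step-keeps (x∈p∧x∉q⇒x∈p─q (All.lookup S⊆B z∈S) z∉F)
      ... | there i  = let (y∈S , zy) , y∉F = All.lookupAny nbrs i in
                       step-spreads (x∈p∧x∉q⇒x∈p─q (All.lookup S⊆B y∈S) y∉F) (Adj-sym zy)

  edge⇒¬Winnable₁ : HasEdge G → ¬ Winnable G 1
  edge⇒¬Winnable₁ (u , v , uv) = sustaining⇒¬Winnable {x = u} {S = v ∷ []} sustaining
    where
    sustaining : Sustaining 1 (u ∷ v ∷ [])
    sustaining (here refl)         = v ∷ [] , refl , [] ∷ [] , (there (here refl) , uv) ∷ []
    sustaining (there (here refl)) = u ∷ [] , refl , [] ∷ [] , (here refl , Adj-sym uv) ∷ []

  two-neighbours : ∀ {S x a b} → a ≢ b → a ∈ S → b ∈ S → Adj G x a → Adj G x b → NeighboursIn 2 S x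
  two-neighbours a≢b a∈S b∈S xa xb = _ , refl , (a≢b ∷ []) ∷ [] ∷ [] , (a∈S , xa) ∷ (b∈S , xb) ∷ []

  -- The ends may coincide, so that cycles are covered.
  interior-neighbours : ∀ p L q → Linked (Adj G) (p ∷ L ++ [ q ]) → Unique (p ∷ L) → q ∉ L →
                        (p ≡ q → 2 ≤ length L) → ∀ {z} → z ∈ L →
                        ∃[ a ] ∃[ b ] (a ≢ b × a ∈ p ∷ L ++ [ q ] × b ∈ p ∷ L ++ [ q ] × Adj G z a × Adj G z b)
  interior-neighbours p (l ∷ []) q (pl ∷ lq ∷ [-]) _ _ short (here refl) =
    p , q , (λ p≡q → case short p≡q of λ { (s≤s ()) }) , here refl , there (there (here refl)) , Adj-sym pl , lq
  interior-neighbours p (l ∷ l' ∷ L) q (pl ∷ ll' ∷ _) ((_ ∷ p≢l' ∷ _) ∷ _) _ _ (here refl) =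
    p , l' , p≢l' , here refl , there (there (here refl)) , Adj-sym pl , ll'
  interior-neighbours p (l ∷ L) q (_ ∷ lk) (_ ∷ uL) q∉L _ (there z∈L)
    with a , b , a≢b , a∈ , b∈ , za , zb ←
         interior-neighbours l L q lk uL (q∉L ∘ there) (λ l≡q → ⊥-elim (q∉L (here (≡-sym l≡q)))) z∈L
    = a , b , a≢b , there a∈ , there b∈ , za , zb

  cycle-sustaining : ∀ {x ys} → IsCycle G x ys → Sustaining 2 (x ∷ ys)
  cycle-sustaining {x} {ys} (len , ux@(x∉ys ∷ _) , lk) (there z∈ys)
    with a , b , a≢b , a∈ , b∈ , za , zb ←
         interior-neighbours x ys x lk ux (λ x∈ys → All.lookup x∉ys x∈ys refl) (λ _ → len) z∈ys
    = two-neighbours a≢b (closing a∈) (closing b∈) za zb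
    where
    closing : ∀ {a} → a ∈ x ∷ ys ++ [ x ] → a ∈ x ∷ ys
    closing (here a≡x) = here a≡x
    closing (there a∈) with ∈-++⁻ ys a∈
    ... | inj₁ a∈ys       = there a∈ys
    ... | inj₂ (here a≡x) = here a≡x
  cycle-sustaining {x} {y ∷ ys₁} (len , _ ∷ (y∉ys₁ ∷ _) , xy ∷ lk) (here refl) with initLast ys₁
  ... | [] = case len of λ { (s≤s ()) }
  ... | ys₂ ∷ʳ′ y' =
    two-neighbours (All.lookup y∉ys₁ y'∈ys₁) (there (here refl)) (there (there y'∈ys₁))
                   xy (Adj-sym y'x)
    where
    y'∈ys₁ : y' ∈ ys₂ ∷ʳ y'
    y'∈ys₁ = ∈-++⁺ʳ ys₂ (here refl)
    y'x : Adj G y' x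
    y'x with Linked-++⁻ʳ (y ∷ ys₂) (subst (λ t → Linked (Adj G) (y ∷ t)) (++-assoc ys₂ [ y' ] [ x ]) lk)
    ... | y'x ∷ _ = y'x

  cycle⇒¬Winnable₂ : ∀ {x ys} → IsCycle G x ys → ¬ Winnable G 2
  cycle⇒¬Winnable₂ cycle = sustaining⇒¬Winnable (cycle-sustaining cycle)

  record Spider (c : Fin n) (leg foot : Fin 3 → Fin n) : Set where
    field
      body     : ∀ i → Adj G c (leg i)
      limb     : ∀ i → Adj G (leg i) (foot i)
      foot≢c   : ∀ i → foot i ≢ c
      leg-inj  : ∀ {i j} → i ≢ j → leg i ≢ leg j
      foot≢leg : ∀ {i j} → i ≢ j → foot i ≢ leg j

  module _ {c leg foot} (spider : Spider c leg foot) where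
    open Spider spider

    Full : Subset n → Fin 3 → Set
    Full B i = leg i ∈ₛ B × foot i ∈ₛ B

    Alight : Subset n → Set
    Alight B = c ∈ₛ B × ((∃[ i ] ∃[ j ] (i ≢ j × Full B i × Full B j)) ⊎ ((∀ i → leg i ∈ₛ B) × ∃[ i ] Full B i))

    module _ {B F : Subset n} (∣F∣≤2 : ∣ F ∣ ≤ 2) where

      either-unprotected : ∀ {a b d} → Unique (a ∷ b ∷ d ∷ []) → a ∈ₛ F → b ∉ₛ F ⊎ d ∉ₛ F
      either-unprotected {b = b} {d} u a∈F with b ∈ₛ? F | d ∈ₛ? F
      ... | no b∉F | _      = inj₁ b∉F
      ... | yes _  | no d∉F = inj₂ d∉F
      ... | yes b∈F | yes d∈F = ⊥-elim (pigeonhole u (s≤s ∣F∣≤2) (a∈F ∷ b∈F ∷ d∈F ∷ []))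

      body-leg-foot : ∀ i → Unique (c ∷ leg i ∷ foot i ∷ [])
      body-leg-foot i = (Adj⇒≢ (body i) ∷ foot≢c i ∘ ≡-sym ∷ []) ∷ (Adj⇒≢ (limb i) ∷ []) ∷ [] ∷ []

      body-leg-leg : ∀ {i j} → i ≢ j → Unique (c ∷ leg i ∷ leg j ∷ [])
      body-leg-leg {i} {j} i≢j = (Adj⇒≢ (body i) ∷ Adj⇒≢ (body j) ∷ []) ∷ (leg-inj i≢j ∷ []) ∷ [] ∷ []

      leg-foot-leg : ∀ {i j} → i ≢ j → Unique (leg i ∷ foot i ∷ leg j ∷ [])
      leg-foot-leg {i} {j} i≢j = (Adj⇒≢ (limb i) ∷ leg-inj i≢j ∷ []) ∷ (foot≢leg i≢j ∷ []) ∷ [] ∷ []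

      leg-active⇒full : ∀ {i} → leg i ∈ₛ B → leg i ∉ₛ F → Full (step G B F) i
      leg-active⇒full {i} leg∈B leg∉F = step-keeps active , step-spreads active (limb i)
        where active = x∈p∧x∉q⇒x∈p─q leg∈B leg∉F

      full-survives : ∀ {i} → Full B i → leg i ∉ₛ F ⊎ foot i ∉ₛ F → Full (step G B F) i
      full-survives (leg∈B , _) (inj₁ leg∉F) = leg-active⇒full leg∈B leg∉F
      full-survives {i} (_ , foot∈B) (inj₂ foot∉F) = step-spreads active (Adj-sym (limb i)) , step-keeps active
        where active = x∈p∧x∉q⇒x∈p─q foot∈B foot∉F

      full-or-backup : ∀ {i j} → Full B i → i ≢ j → leg j ∈ₛ B → ∃[ k ] Full (step G B F) k
      full-or-backup {i} {j} full-i i≢j leg-j∈B with leg i ∈ₛ? F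
      ... | no leg-i∉F = i , full-survives full-i (inj₁ leg-i∉F)
      ... | yes leg-i∈F with either-unprotected (leg-foot-leg i≢j) leg-i∈F
      ...   | inj₁ foot-i∉F = i , full-survives full-i (inj₂ foot-i∉F)
      ...   | inj₂ leg-j∉F  = j , leg-active⇒full leg-j∈B leg-j∉F

      relit-by-leg : ∀ {i j} → i ≢ j → Full (step G B F) i → leg j ∈ₛ B → leg j ∉ₛ F → Alight (step G B F)
      relit-by-leg {i} {j} i≢j full-i leg∈B leg∉F =
        step-spreads (x∈p∧x∉q⇒x∈p─q leg∈B leg∉F) (Adj-sym (body j)) ,
        inj₁ (i , j , i≢j , full-i , leg-active⇒full leg∈B leg∉F)

      alight-step : Alight B → Alight (step G B F)
      alight-step (c∈B , burning) with c ∈ₛ? F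
      ... | no c∉F = step-keeps c-active , inj₂ ((λ i → step-spreads c-active (body i)) , survivor burning)
        where
        c-active = x∈p∧x∉q⇒x∈p─q c∈B c∉F
        survivor : _ → ∃[ k ] Full (step G B F) k
        survivor (inj₁ (i , j , i≢j , full-i , leg-j∈B , _)) = full-or-backup full-i i≢j leg-j∈B
        survivor (inj₂ (legs , i , full-i)) with j , _ , i≢j , _ ← other-two i = full-or-backup full-i i≢j (legs j)
      ... | yes c∈F = relit burning
        where
        survives : ∀ {i} → Full B i → Full (step G B F) i
        survives {i} full = full-survives full (either-unprotected (body-leg-foot i) c∈F)
        relit : _ → Alight (step G B F)
        relit (inj₁ (i , j , i≢j , full-i , full-j)) with either-unprotected (body-leg-leg i≢j) c∈F
        ... | inj₁ leg-i∉F = relit-by-leg (i≢j ∘ ≡-sym) (survives full-j) (proj₁ full-i) leg-i∉F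
        ... | inj₂ leg-j∉F = relit-by-leg i≢j (survives full-i) (proj₁ full-j) leg-j∉F
        relit (inj₂ (legs , i , full-i)) with j , k , i≢j , i≢k , j≢k ← other-two i
                                          with either-unprotected (body-leg-leg j≢k) c∈F
        ... | inj₁ leg-j∉F = relit-by-leg i≢j (survives full-i) (legs j) leg-j∉F
        ... | inj₂ leg-k∉F = relit-by-leg i≢k (survives full-i) (legs k) leg-k∉F

    spider⇒¬Winnable₂ : ¬ Winnable G 2
    spider⇒¬Winnable₂ = invariant⇒¬Winnable Alight
      (∈⊤ , inj₁ (zero , suc zero , (λ ()) , (∈⊤ , ∈⊤) , (∈⊤ , ∈⊤))) (∉⊥ ∘ proj₁) alight-step

  -- Acyclic spider-free graphs are caterpillar forests

  module _ (acyclic : ∀ x ys → ¬ IsCycle G x ys)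
           (spider-free : ∀ {c leg foot} → ¬ Spider c leg foot) where

    Inner : Fin n → Set
    Inner z = ∃[ a ] ∃[ b ] (a ≢ b × Adj G z a × Adj G z b)

    Inner? : ∀ z → Dec (Inner z)
    Inner? z = any? λ a → any? λ b → ¬? (a ≟ᶠ b) ×-dec Adj? z a ×-dec Adj? z b

    ¬Inner⇒≡ : ∀ {z a b} → ¬ Inner z → Adj G z a → Adj G z b → a ≡ b
    ¬Inner⇒≡ {a = a} {b} ¬inner za zb with a ≟ᶠ b
    ... | yes a≡b = a≡b
    ... | no  a≢b = ⊥-elim (¬inner (a , b , a≢b , za , zb))

    another-neighbour : ∀ {b} → Inner b → ∀ z → ∃[ b' ] (b' ≢ z × Adj G b b')
    another-neighbour (a , a' , a≢a' , ba , ba') z with a ≟ᶠ z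
    ... | yes refl = a' , a≢a' ∘ ≡-sym , ba'
    ... | no  a≢z  = a , a≢z , ba

    triangle-free : ∀ {a b d} → Adj G a b → Adj G b d → ¬ Adj G d a
    triangle-free {a} {b} {d} ab bd da =
      acyclic a (b ∷ d ∷ []) (s≤s (s≤s z≤n) , distinct , ab ∷ bd ∷ da ∷ [-])
      where distinct = (Adj⇒≢ ab ∷ Adj⇒≢ da ∘ ≡-sym ∷ []) ∷ (Adj⇒≢ bd ∷ []) ∷ [] ∷ []

    spider-at : ∀ {x p s y} → Adj G x p → Adj G x s → Adj G x y → p ≢ s → p ≢ y → s ≢ y →
                Inner p → Inner s → Inner y → ⊥
    spider-at {x} {p} {s} {y} xp xs xy p≢s p≢y s≢y inner-p inner-s inner-y = spider-free {x} {leg} {foot} record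
      { body     = body
      ; limb     = limb
      ; foot≢c   = λ i → proj₁ (proj₂ (foot-of i))
      ; leg-inj  = triple-injective p≢s p≢y s≢y
      ; foot≢leg = λ {i} {j} _ foot≡leg →
                     triangle-free (body i) (subst (Adj G (leg i)) foot≡leg (limb i)) (Adj-sym (body j))
      }
      where
      leg = triple p s y
      body : ∀ i → Adj G x (leg i)
      body = triple-all {P = Adj G x} xp xs xy
      foot-of : ∀ i → ∃[ f ] (f ≢ x × Adj G (leg i) f)
      foot-of i = another-neighbour (triple-all {P = Inner} inner-p inner-s inner-y i) x
      foot = proj₁ ∘ foot-of
      limb : ∀ i → Adj G (leg i) (foot i)
      limb = proj₂ ∘ proj₂ ∘ foot-of

    module _ (v : Fin n) where

      InnerPath : List (Fin n) → Set
      InnerPath Q = IsPath G Q × All Inner Q × All (Reach G v) Q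

      Stuck : Fin n → List (Fin n) → Set
      Stuck e Q = ∀ {y} → Adj G e y → Inner y → y ∈ Q

      InnerClosed : List (Fin n) → Set
      InnerClosed Q = ∀ {x} → x ∈ Q → Stuck x Q

      InnerPath-reverse : ∀ {Q} → InnerPath Q → InnerPath (reverse Q)
      InnerPath-reverse ((u , lk) , inner , reach) =
        (Unique-reverse u , Linked-reverse Adj-sym lk) , All-reverse inner , All-reverse reach

      Extension : List (Fin n) → Set
      Extension Q = ∃[ e ] ∃[ Q' ] ∃[ ext ] (e ∷ Q' ≡ ext ++ Q × InnerPath (e ∷ Q') × Stuck e (e ∷ Q'))

      -- A path has at most n nodes, so the fuel never runs out.
      extend : ∀ fuel {e Q} → n < length (e ∷ Q) + fuel → InnerPath (e ∷ Q) → Extension (e ∷ Q)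
      extend zero {e} {Q} n<len ((u , _) , _) =
        ⊥-elim (<-irrefl refl (<-≤-trans (subst (n <_) (+-identityʳ _) n<len) (Unique⇒length≤n u)))
      extend (suc fuel) {e} {Q} n<len path@((u , lk) , inner , reach)
        with any? (λ y → Adj? e y ×-dec Inner? y ×-dec ¬? (y ∈? e ∷ Q))
      ... | yes (y , ey , inner-y , y∉)
        with e' , Q' , ext , eq , path' , stuck ←
             extend fuel (subst (n <_) (+-suc (length (e ∷ Q)) fuel) n<len)
                    ((¬Any⇒All¬ _ y∉ ∷ u , Adj-sym ey ∷ lk) , inner-y ∷ inner , there (All.head reach) ey ∷ reach)
        = e' , Q' , ext ++ [ y ] , trans eq (≡-sym (++-assoc ext [ y ] (e ∷ Q))) , path' , stuck
      ... | no none = e , Q , [] , refl , path , stuck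
        where
        stuck : Stuck e (e ∷ Q)
        stuck {y} ey inner-y with y ∈? e ∷ Q
        ... | yes y∈ = y∈
        ... | no  y∉ = ⊥-elim (none (y , ey , inner-y , y∉))

      interior-closed : ∀ {a L e x} → InnerPath (a ∷ L ++ [ e ]) → x ∈ L → Stuck x (a ∷ L ++ [ e ])
      interior-closed {a} {L} {e} ((u@(a∉ ∷ uL) , lk) , inner , _) x∈L {y} xy inner-y with y ∈? a ∷ L ++ [ e ]
      ... | yes y∈ = y∈
      ... | no  y∉
        with p , s , p≢s , p∈ , s∈ , xp , xs ←
             interior-neighbours a L e lk (Unique-++⁻ˡ (a ∷ L) u) (Unique-∷ʳ⁻ L uL)
                                 (⊥-elim ∘ All.lookup a∉ (∈-++⁺ʳ L (here refl))) x∈L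
        = ⊥-elim (spider-at xp xs xy p≢s (λ { refl → y∉ p∈ }) (λ { refl → y∉ s∈ })
                            (All.lookup inner p∈) (All.lookup inner s∈) inner-y)

      closed-between-stuck-ends : ∀ K e {a Q} → a ∷ Q ≡ K ++ [ e ] → InnerPath (a ∷ Q) →
                                  Stuck a (a ∷ Q) → Stuck e (a ∷ Q) → InnerClosed (a ∷ Q)
      closed-between-stuck-ends []      e refl _    stuck-a _       (here refl) = stuck-a
      closed-between-stuck-ends (k ∷ L) e refl _    stuck-a _       (here refl) = stuck-a
      closed-between-stuck-ends (k ∷ L) e refl path _       stuck-e (there x∈) with ∈-++⁻ L x∈
      ... | inj₁ x∈L        = interior-closed path x∈L
      ... | inj₂ (here refl) = stuck-e

      closed-path-through : ∀ {s} → Inner s → Reach G v s → ∃[ Q ] (InnerPath Q × InnerClosed Q × s ∈ Q)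
      closed-path-through {s} inner-s reach-s
        with e₁ , Q₁ , ext₁ , eq₁ , path₁ , stuck₁ ←
             extend n (n<1+n n) (([] ∷ [] , [-]) , inner-s ∷ [] , reach-s ∷ [])
        with h , t , rev-eq ← reverse-∷ e₁ Q₁
        with e₂ , Q₂ , ext₂ , eq₂ , path₂ , stuck₂ ←
             extend n (s≤s (m≤n+m n (length t))) (subst InnerPath rev-eq (InnerPath-reverse path₁))
        = e₂ ∷ Q₂ , path₂ , closed , Q₁⊆Q₂ (subst (s ∈_) (≡-sym eq₁) (∈-++⁺ʳ ext₁ (here refl)))
        where
        Q₁⊆Q₂ : ∀ {z} → z ∈ e₁ ∷ Q₁ → z ∈ e₂ ∷ Q₂
        Q₁⊆Q₂ {z} z∈ = subst (z ∈_) (≡-sym eq₂) (∈-++⁺ʳ ext₂ (subst (z ∈_) rev-eq (Any.reverse⁺ z∈)))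
        ends : e₂ ∷ Q₂ ≡ (ext₂ ++ reverse Q₁) ++ [ e₁ ]
        ends = begin
          e₂ ∷ Q₂                       ≡⟨ eq₂ ⟩
          ext₂ ++ h ∷ t                 ≡⟨ cong (ext₂ ++_) (trans (≡-sym rev-eq) (unfold-reverse e₁ Q₁)) ⟩
          ext₂ ++ (reverse Q₁ ++ [ e₁ ]) ≡⟨ ≡-sym (++-assoc ext₂ (reverse Q₁) [ e₁ ]) ⟩
          (ext₂ ++ reverse Q₁) ++ [ e₁ ] ∎
          where open ≡-Reasoning
        closed = closed-between-stuck-ends (ext₂ ++ reverse Q₁) e₁ ends path₂ stuck₂
                                           (λ e₁y inner-y → Q₁⊆Q₂ (stuck₁ e₁y inner-y))

      Dominated : List (Fin n) → Fin n → Set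
      Dominated Q z = z ∈ Q ⊎ (¬ Inner z × ∃[ q ] (q ∈ Q × Adj G q z))

      dominated-step : ∀ {Q u w} → InnerClosed Q → Dominated Q u → Adj G u w → Dominated Q w
      dominated-step {Q} {w = w} closed (inj₁ u∈Q) uw with w ∈? Q | Inner? w
      ... | yes w∈Q | _         = inj₁ w∈Q
      ... | no  w∉Q | yes inner-w = ⊥-elim (w∉Q (closed u∈Q uw inner-w))
      ... | no  _   | no ¬inner-w = inj₂ (¬inner-w , _ , u∈Q , uw)
      dominated-step _ (inj₂ (¬inner-u , q , q∈Q , qu)) uw with ¬Inner⇒≡ ¬inner-u (Adj-sym qu) uw
      ... | refl = inj₁ q∈Q

      dominated-reach : ∀ {Q w} → InnerClosed Q → Dominated Q v → Reach G v w → Dominated Q w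
      dominated-reach closed dom-v here         = dom-v
      dominated-reach closed dom-v (there r uw) = dominated-step closed (dominated-reach closed dom-v r) uw

      caterpillar-of : ∀ {Q} → IsPath G Q → All (Reach G v) Q → InnerClosed Q → Dominated Q v →
                       ComponentIsCaterpillar G v
      caterpillar-of {Q} path reach closed dom-v =
        (λ x ys cycle _ → acyclic x ys cycle) , Q , path , reach ,
        λ w v⇝w → spine-or-leaf (dominated-reach closed dom-v v⇝w)
        where
        spine-or-leaf : ∀ {w} → Dominated Q w → Any (λ p → p ≡ w ⊎ Adj G p w) Q
        spine-or-leaf (inj₁ w∈Q)                = Any.map (inj₁ ∘ ≡-sym) w∈Q
        spine-or-leaf (inj₂ (_ , _ , q∈Q , qw)) = Any.map (λ { refl → inj₂ qw }) q∈Q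

      component-is-caterpillar : ComponentIsCaterpillar G v
      component-is-caterpillar with Inner? v
      ... | yes inner-v
        with Q , (path , _ , reach) , closed , v∈Q ← closed-path-through inner-v here
        = caterpillar-of path reach closed (inj₁ v∈Q)
      ... | no ¬inner-v with any? (Adj? v)
      ...   | no isolated =
        caterpillar-of ([] ∷ [] , [-]) (here ∷ []) (λ { (here refl) vy _ → ⊥-elim (isolated (_ , vy)) })
                       (inj₁ (here refl))
      ...   | yes (u , vu) with Inner? u
      ...     | yes inner-u
        with Q , (path , _ , reach) , closed , u∈Q ← closed-path-through inner-u (there here vu)
        = caterpillar-of path reach closed (inj₂ (¬inner-v , u , u∈Q , Adj-sym vu))
      ...     | no ¬inner-u =
        caterpillar-of ((Adj⇒≢ vu ∷ []) ∷ [] ∷ [] , vu ∷ [-]) (here ∷ there here vu ∷ []) closed (inj₁ (here refl))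
        where
        closed : InnerClosed (v ∷ u ∷ [])
        closed (here refl) vy _ with ¬Inner⇒≡ ¬inner-v vy vu
        ... | refl = there (here refl)
        closed (there (here refl)) uy _ with ¬Inner⇒≡ ¬inner-u uy (Adj-sym vu)
        ... | refl = here refl

  -- Extinguishing caterpillar forests

  Safe : Subset n → (Fin n → Set) → Set
  Safe B C = ∀ {x} → C x → x ∉ₛ B

  Closed : (Fin n → Set) → Set
  Closed C = ∀ {x y} → C x → Adj G x y → C y

  Fenced : (Fin n → Set) → Fin n → Set
  Fenced C h = ∀ {x y} → C x → Adj G x y → C y ⊎ y ≡ h

  safe-everywhere⇒∅ : ∀ {B} → Safe B (λ _ → ⊤) → B ≡ ∅
  safe-everywhere⇒∅ safe = Empty-unique λ (x , x∈B) → safe tt x∈B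

  safe-step : ∀ {B F} {C C' : Fin n → Set} → Safe B C → (∀ {x} → C' x → x ∈ₛ F ⊎ C x) →
              (∀ {x y} → C' x → Adj G x y → y ∈ₛ F ⊎ C y) → Safe (step G B F) C'
  safe-step {B} {F} {C} safe within nbrs C'x x∈ =
    [ (λ x∈B─F → extinguished (within C'x) x∈B─F)
    , (λ (y , y∈B─F , yx) → extinguished (nbrs C'x (Adj-sym yx)) y∈B─F) ]′ (∈step⁻ x∈)
    where
    extinguished : ∀ {z} → z ∈ₛ F ⊎ C z → z ∉ₛ B ─ F
    extinguished (inj₁ z∈F) z∈B─F = proj₂ (x∈p─q⁻ B F z∈B─F) z∈F
    extinguished (inj₂ Cz)  z∈B─F = safe Cz (proj₁ (x∈p─q⁻ B F z∈B─F))

  sweep : ∀ (guard : Fin n → Subset n) {C T : Fin n → Set} → (∀ w → w ∈ₛ guard w) →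
          (∀ {w x y} → C x ⊎ T x → Adj G x y → y ∈ₛ guard w ⊎ C y) →
          ∀ Ws {B} → Safe B C → Safe (burn G B (map guard Ws)) (λ x → C x ⊎ (T x × x ∈ Ws))
  sweep guard w∈guard fence []       safe (inj₁ Cx) = safe Cx
  sweep guard {C} {T} w∈guard fence (w ∷ Ws) safe =
    λ cleared → sweep guard {C'} {T} w∈guard fence' Ws (safe-step safe within (fence ∘ forget)) (regroup cleared)
    where
    C' : Fin n → Set
    C' x = C x ⊎ (T x × x ≡ w)
    forget : ∀ {x} → C' x → C x ⊎ T x
    forget = [ inj₁ , inj₂ ∘ proj₁ ]′
    fence' : ∀ {w' x y} → C' x ⊎ T x → Adj G x y → y ∈ₛ guard w' ⊎ C' y
    fence' C'x⊎Tx xy = Sum.map₂ inj₁ (fence ([ forget , inj₂ ]′ C'x⊎Tx) xy)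
    within : ∀ {x} → C' x → x ∈ₛ guard w ⊎ C x
    within (inj₁ Cx)         = inj₂ Cx
    within (inj₂ (_ , refl)) = inj₁ (w∈guard w)
    regroup : ∀ {x} → C x ⊎ (T x × x ∈ w ∷ Ws) → C' x ⊎ (T x × x ∈ Ws)
    regroup (inj₁ Cx)               = inj₁ (inj₁ Cx)
    regroup (inj₂ (Tx , here refl)) = inj₁ (inj₂ (Tx , refl))
    regroup (inj₂ (Tx , there x∈))  = inj₂ (Tx , x∈)

-- The last spine node has no successor; there next returns the node itself.
next : Fin n → List (Fin n) → Fin n
next p []      = p
next p (q ∷ _) = q

spine-strategy : List (Fin n) → List (Subset n)
spine-strategy []         = []
spine-strategy {n} (p ∷ rest) = map (pair p) (allFin n) ++ pair p (next p rest) ∷ spine-strategy rest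

spine-strategy-small : ∀ (S : List (Fin n)) → All (λ F → ∣ F ∣ ≤ 2) (spine-strategy S)
spine-strategy-small []         = []
spine-strategy-small (p ∷ rest) =
  All.++⁺ (All.map⁺ (All.universal (∣pair∣≤2 p) _)) (∣pair∣≤2 p (next p rest) ∷ spine-strategy-small rest)

module Spine (G : Graph n) {v : Fin n} (tree : ComponentIsTree G v) {P : List (Fin n)}
             (P-path : IsPath G P) (P⊆comp : All (Reach G v) P)
             (P-dominates : ∀ w → Reach G v w → Any (λ p → p ≡ w ⊎ Adj G p w) P) where

  segment : ∀ A a L b R → P ≡ A ++ a ∷ L ++ b ∷ R →
            IsPath G (a ∷ L ++ [ b ]) × (∀ {z} → z ∈ a ∷ L ++ [ b ] → z ∈ P)
  segment A a L b R P≡ =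
    (Unique-++⁻ˡ (a ∷ L ++ [ b ]) (Unique-++⁻ʳ A (subst Unique P≡' (proj₁ P-path))) ,
     Linked-++⁻ˡ (a ∷ L ++ [ b ]) (Linked-++⁻ʳ A (subst (Linked (Adj G)) P≡' (proj₂ P-path)))) ,
    λ {z} z∈ → subst (z ∈_) (≡-sym P≡') (∈-++⁺ʳ A (∈-++⁺ˡ z∈))
    where
    P≡' : P ≡ A ++ (a ∷ L ++ [ b ]) ++ R
    P≡' = trans P≡ (cong (λ t → A ++ a ∷ t) (≡-sym (++-assoc L [ b ] R)))

  no-detour : ∀ A a L b R E → P ≡ A ++ a ∷ L ++ b ∷ R → Linked (Adj G) (b ∷ E ++ [ a ]) → Unique E →
              All (_∉ P) E → L ++ E ≢ [] → ⊥
  no-detour A a L b R E P≡ b⇝a uE E∉P L++E≢[]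
    with (u-seg , lk-seg) , seg⊆P ← segment A a L b R P≡
    = tree a (L ++ b ∷ E) (2≤length L E L++E≢[] , unique , linked)
           (All.++⁻ˡ (a ∷ L ++ b ∷ E) (Reach-Linked G (All.lookup P⊆comp (seg⊆P (here refl))) linked))
    where
    unique : Unique (a ∷ L ++ b ∷ E)
    unique = subst (λ t → Unique (a ∷ t)) (++-assoc L [ b ] E)
               (Unique.++⁺ u-seg uE λ (z∈seg , z∈E) → All.lookup E∉P z∈E (seg⊆P z∈seg))
    linked : Linked (Adj G) (a ∷ (L ++ b ∷ E) ++ [ a ])
    linked = subst (λ t → Linked (Adj G) (a ∷ t)) (≡-sym (++-assoc L (b ∷ E) [ a ]))
                   (Linked-glue (a ∷ L) lk-seg b⇝a)

  forward-neighbour : ∀ Pre p rest → P ≡ Pre ++ p ∷ rest → ∀ {y} → Adj G p y → y ∈ Pre ⊎ y ∉ P ⊎ y ≡ next p rest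
  forward-neighbour Pre p rest P≡ {y} py with y ∈? P
  ... | no y∉P = inj₂ (inj₁ y∉P)
  ... | yes y∈P with ∈-++⁻ Pre (subst (y ∈_) P≡ y∈P)
  ...   | inj₁ y∈Pre        = inj₁ y∈Pre
  ...   | inj₂ (here refl)  = ⊥-elim (Adj⇒≢ G py refl)
  forward-neighbour Pre p (q ∷ rest) P≡ py | yes _ | inj₂ (there (here refl)) = inj₂ (inj₂ refl)
  forward-neighbour Pre p (q ∷ rest) P≡ {y} py | yes _ | inj₂ (there (there y∈rest))
    with L , R , refl ← ∈-∃++ y∈rest
    = ⊥-elim (no-detour Pre p (q ∷ L) y R [] P≡ (Adj-sym G py ∷ [-]) [] [] λ ())

  no-bridge : ∀ {a b} E → a ∈ P → b ∈ P → a ≢ b → Linked (Adj G) (a ∷ E ++ [ b ]) → Unique E →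
              All (_∉ P) E → E ≢ [] → ⊥
  no-bridge {a} {b} E a∈P b∈P a≢b a⇝b uE E∉P E≢[] with ∈-∈-split a∈P b∈P a≢b
  ... | inj₂ (A , L , R , P≡) = no-detour A b L a R E P≡ a⇝b uE E∉P (E≢[] ∘ ++-conicalʳ L E)
  ... | inj₁ (A , L , R , P≡) =
    no-detour A a L b R (reverse E) P≡ b⇝a (Unique-reverse uE) (All-reverse E∉P)
              (E≢[] ∘ reverse-injective ∘ ++-conicalʳ L (reverse E))
    where
    b⇝a : Linked (Adj G) (b ∷ reverse E ++ [ a ])
    b⇝a = subst (Linked (Adj G)) reversed (Linked-reverse (Adj-sym G) a⇝b)
      where
      reversed : reverse (a ∷ E ++ [ b ]) ≡ b ∷ reverse E ++ [ a ]
      reversed = begin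
        reverse (a ∷ E ++ [ b ])   ≡⟨ unfold-reverse a (E ++ [ b ]) ⟩
        reverse (E ++ [ b ]) ∷ʳ a  ≡⟨ cong (_∷ʳ a) (reverse-++ E [ b ]) ⟩
        b ∷ reverse E ++ [ a ]     ∎
        where open ≡-Reasoning

  hanging-leaf : ∀ {q w y} → q ∈ P → w ∉ P → Adj G q w → Adj G w y → y ≡ q
  hanging-leaf {q} {w} {y} q∈P w∉P qw wy with y ≟ᶠ q
  ... | yes y≡q = y≡q
  ... | no  y≢q with y ∈? P
  ...   | yes y∈P = ⊥-elim (no-bridge [ w ] q∈P y∈P (y≢q ∘ ≡-sym) (qw ∷ wy ∷ [-]) ([] ∷ []) (w∉P ∷ []) λ ())
  ...   | no  y∉P with find (P-dominates y (there (there (All.lookup P⊆comp q∈P) qw) wy))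
  ...     | r , r∈P , inj₁ refl = ⊥-elim (y∉P r∈P)
  ...     | r , r∈P , inj₂ ry with r ≟ᶠ q
  ...       | yes refl = ⊥-elim (tree q (w ∷ y ∷ [])
                                   (s≤s (s≤s z≤n) , distinct , qw ∷ wy ∷ Adj-sym G ry ∷ [-])
                                   (Reach-Linked G (All.lookup P⊆comp q∈P) (qw ∷ wy ∷ [-])))
    where distinct = (Adj⇒≢ G qw ∷ (λ { refl → y∉P q∈P }) ∷ []) ∷ (Adj⇒≢ G wy ∷ []) ∷ [] ∷ []
  ...       | no  r≢q = ⊥-elim (no-bridge (w ∷ y ∷ []) q∈P r∈P (r≢q ∘ ≡-sym) (qw ∷ wy ∷ Adj-sym G ry ∷ [-])
                                          ((Adj⇒≢ G wy ∷ []) ∷ [] ∷ []) (w∉P ∷ y∉P ∷ []) λ ())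

  module _ {C₀ : Fin n → Set} (C₀-closed : Closed G C₀) where

    Cleared : List (Fin n) → Fin n → Set
    Cleared Pre z = C₀ z ⊎ z ∈ Pre ⊎ ∃[ q ] (q ∈ Pre × z ∉ P × Adj G q z)

    Cleared-∷ʳ : ∀ {Pre p z} → Cleared Pre z → Cleared (Pre ∷ʳ p) z
    Cleared-∷ʳ (inj₁ C₀z)                     = inj₁ C₀z
    Cleared-∷ʳ (inj₂ (inj₁ z∈Pre))            = inj₂ (inj₁ (∈-++⁺ˡ z∈Pre))
    Cleared-∷ʳ (inj₂ (inj₂ (q , q∈Pre , leaf))) = inj₂ (inj₂ (q , ∈-++⁺ˡ q∈Pre , leaf))

    fence-advance : ∀ Pre p rest → P ≡ Pre ++ p ∷ rest → Fenced G (Cleared Pre) p →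
                    Fenced G (Cleared (Pre ∷ʳ p)) (next p rest)
    fence-advance Pre p rest P≡ fence (inj₁ C₀x) xy = inj₁ (inj₁ (C₀-closed C₀x xy))
    fence-advance Pre p rest P≡ fence (inj₂ (inj₁ x∈)) xy with ∈-++⁻ Pre x∈
    ... | inj₁ x∈Pre = [ inj₁ ∘ Cleared-∷ʳ , (λ { refl → inj₁ (inj₂ (inj₁ (∈-++⁺ʳ Pre (here refl)))) }) ]′
                         (fence (inj₂ (inj₁ x∈Pre)) xy)
    ... | inj₂ (here refl) with forward-neighbour Pre p rest P≡ xy
    ...   | inj₁ y∈Pre        = inj₁ (inj₂ (inj₁ (∈-++⁺ˡ y∈Pre)))
    ...   | inj₂ (inj₁ y∉P)   = inj₁ (inj₂ (inj₂ (p , ∈-++⁺ʳ Pre (here refl) , y∉P , xy)))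
    ...   | inj₂ (inj₂ y≡nxt) = inj₂ y≡nxt
    fence-advance Pre p rest P≡ fence (inj₂ (inj₂ (q , q∈ , x∉P , qx))) xy
      with hanging-leaf (subst (q ∈_) (≡-sym P≡') (∈-++⁺ˡ q∈)) x∉P qx xy
      where P≡' = trans P≡ (≡-sym (++-assoc Pre [ p ] rest))
    ... | refl = inj₁ (inj₂ (inj₁ q∈))

    clear-spine-node : ∀ Pre p rest {B} → P ≡ Pre ++ p ∷ rest → Fenced G (Cleared Pre) p →
                       Safe G B (Cleared Pre) →
                       Safe G (step G (burn G B (map (pair p) (allFin n))) (pair p (next p rest)))
                              (Cleared (Pre ∷ʳ p))
    clear-spine-node Pre p rest P≡ fence safe = safe-step G swept within nbrs
      where
      p∈P = subst (p ∈_) (≡-sym P≡) (∈-++⁺ʳ Pre (here refl))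
      Leaf : Fin n → Set
      Leaf z = z ∉ P × Adj G p z
      leaves-fenced : ∀ {w x y} → Cleared Pre x ⊎ Leaf x → Adj G x y → y ∈ₛ pair p w ⊎ Cleared Pre y
      leaves-fenced {w} (inj₁ c) xy = [ inj₂ , (λ { refl → inj₁ (a∈pair p w) }) ]′ (fence c xy)
      leaves-fenced {w} (inj₂ (x∉P , px)) xy with hanging-leaf p∈P x∉P px xy
      ... | refl = inj₁ (a∈pair p w)
      swept = sweep G (pair p) (b∈pair p) leaves-fenced (allFin n) safe
      Swept : Fin n → Set
      Swept x = Cleared Pre x ⊎ (Leaf x × x ∈ allFin n)
      within : ∀ {x} → Cleared (Pre ∷ʳ p) x → x ∈ₛ pair p (next p rest) ⊎ Swept x
      within (inj₁ C₀x) = inj₂ (inj₁ (inj₁ C₀x))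
      within (inj₂ (inj₁ x∈)) with ∈-++⁻ Pre x∈
      ... | inj₁ x∈Pre       = inj₂ (inj₁ (inj₂ (inj₁ x∈Pre)))
      ... | inj₂ (here refl) = inj₁ (a∈pair p _)
      within {x} (inj₂ (inj₂ (q , q∈ , x∉P , qx))) with ∈-++⁻ Pre q∈
      ... | inj₁ q∈Pre       = inj₂ (inj₁ (inj₂ (inj₂ (q , q∈Pre , x∉P , qx))))
      ... | inj₂ (here refl) = inj₂ (inj₂ ((x∉P , qx) , ∈-allFin x))
      nbrs : ∀ {x y} → Cleared (Pre ∷ʳ p) x → Adj G x y → y ∈ₛ pair p (next p rest) ⊎ Swept y
      nbrs c xy = [ within , (λ { refl → inj₁ (b∈pair p _) }) ]′ (fence-advance Pre p rest P≡ fence c xy)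

    clear-spine : ∀ Pre p rest {B} → P ≡ Pre ++ p ∷ rest → Fenced G (Cleared Pre) p → Safe G B (Cleared Pre) →
                  Safe G (burn G B (spine-strategy (p ∷ rest))) (Cleared P)
    clear-spine Pre p rest {B} P≡ fence safe =
      subst (λ B' → Safe G B' (Cleared P)) (≡-sym (burn-++ G B (map (pair p) (allFin n)) _))
            (continue rest P≡ (fence-advance Pre p rest P≡ fence) (clear-spine-node Pre p rest P≡ fence safe))
      where
      continue : ∀ rest {B'} → P ≡ Pre ++ p ∷ rest → Fenced G (Cleared (Pre ∷ʳ p)) (next p rest) →
                 Safe G B' (Cleared (Pre ∷ʳ p)) → Safe G (burn G B' (spine-strategy rest)) (Cleared P)
      continue []         P≡ _     safe' = subst (λ Q → Safe G _ (Cleared Q)) (≡-sym P≡) safe'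
      continue (q ∷ rest) P≡ fence' safe' =
        clear-spine (Pre ∷ʳ p) q rest (trans P≡ (≡-sym (++-assoc Pre [ p ] (q ∷ rest)))) fence' safe'

    component-cleared : ∀ {B} → Safe G B C₀ → Safe G (burn G B (spine-strategy P)) (λ z → C₀ z ⊎ Reach G v z)
    component-cleared {B} safe = spine-cleared P refl (P-dominates v here) ∘ cleared
      where
      spine-cleared : ∀ Q → P ≡ Q → Any _ Q → Safe G (burn G B (spine-strategy Q)) (Cleared P)
      spine-cleared (p ∷ rest) P≡ _ = clear-spine [] p rest P≡ fence₀ safe₀
        where
        fence₀ : Fenced G (Cleared []) p
        fence₀ (inj₁ C₀x) xy = inj₁ (inj₁ (C₀-closed C₀x xy))
        fence₀ (inj₂ (inj₁ ()))
        fence₀ (inj₂ (inj₂ (_ , () , _)))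
        safe₀ : Safe G B (Cleared [])
        safe₀ (inj₁ C₀x) = safe C₀x
        safe₀ (inj₂ (inj₁ ()))
        safe₀ (inj₂ (inj₂ (_ , () , _)))
      cleared : ∀ {z} → C₀ z ⊎ Reach G v z → Cleared P z
      cleared (inj₁ C₀z) = inj₁ C₀z
      cleared {z} (inj₂ v⇝z) with find (P-dominates z v⇝z)
      ... | q , q∈P , inj₁ refl = inj₂ (inj₁ q∈P)
      ... | q , q∈P , inj₂ qz with z ∈? P
      ...   | yes z∈P = inj₂ (inj₁ z∈P)
      ...   | no  z∉P = inj₂ (inj₂ (q , q∈P , z∉P , qz))

module _ (G : Graph n) where

  noEdges⇒Winnable₁ : NoEdges G → Winnable G 1
  noEdges⇒Winnable₁ no-edges =
    map ⁅_⁆ (allFin n) , All.map⁺ (All.universal (λ x → ≤-reflexive (∣⁅x⁆∣≡1 x)) _) ,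
    safe-everywhere⇒∅ G λ {x} _ → swept (inj₂ (tt , ∈-allFin x))
    where
    swept = sweep G ⁅_⁆ {λ _ → ⊥} {λ _ → ⊤} x∈⁅x⁆
                  (λ {_} {x} {y} _ xy → case trans (≡-sym xy) (no-edges x y) of λ ()) (allFin n) {V} λ ()

  caterpillar-cleared : ∀ {v C₀ B} (caterpillar : ComponentIsCaterpillar G v) → Closed G C₀ → Safe G B C₀ →
                        Safe G (burn G B (spine-strategy (proj₁ (proj₂ caterpillar)))) (λ z → C₀ z ⊎ Reach G v z)
  caterpillar-cleared (tree , _ , path , reach , dominates) closed =
    Spine.component-cleared G tree path reach dominates closed

  caterpillars⇒Winnable₂ : (∀ v → ComponentIsCaterpillar G v) → Winnable G 2
  caterpillars⇒Winnable₂ caterpillar =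
    strategy (allFin n) , All.concat⁺ (All.map⁺ (All.universal (spine-strategy-small ∘ spine) (allFin n))) ,
    safe-everywhere⇒∅ G λ {x} _ →
      cleared (allFin n) {λ _ → ⊥} (λ ()) (λ ()) (inj₂ (Any.map (λ { refl → here }) (∈-allFin x)))
    where
    spine : Fin n → List (Fin n)
    spine v = proj₁ (proj₂ (caterpillar v))
    strategy : List (Fin n) → List (Subset n)
    strategy = concatMap (spine-strategy ∘ spine)
    cleared : ∀ vs {C₀ B} → Closed G C₀ → Safe G B C₀ →
              Safe G (burn G B (strategy vs)) (λ z → C₀ z ⊎ Any (λ u → Reach G u z) vs)
    cleared []       _      safe (inj₁ C₀z) = safe C₀z
    cleared (v ∷ vs) {C₀} {B} closed safe =
      subst (λ B' → Safe G B' (λ z → C₀ z ⊎ Any (λ u → Reach G u z) (v ∷ vs)))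
            (≡-sym (burn-++ G B (spine-strategy (spine v)) (strategy vs)))
            (cleared vs closed' (caterpillar-cleared (caterpillar v) closed safe) ∘ regroup)
      where
      closed' : Closed G (λ z → C₀ z ⊎ Reach G v z)
      closed' (inj₁ C₀x) xy = inj₁ (closed C₀x xy)
      closed' (inj₂ v⇝x) xy = inj₂ (there v⇝x xy)
      regroup : ∀ {z} → C₀ z ⊎ Any (λ u → Reach G u z) (v ∷ vs) →
                (C₀ z ⊎ Reach G v z) ⊎ Any (λ u → Reach G u z) vs
      regroup (inj₁ C₀z)          = inj₁ (inj₁ C₀z)
      regroup (inj₂ (here v⇝z))   = inj₁ (inj₂ v⇝z)
      regroup (inj₂ (there v⇝z))  = inj₂ v⇝z

  Winnable₂⇒caterpillars : Winnable G 2 → ∀ v → ComponentIsCaterpillar G v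
  Winnable₂⇒caterpillars win =
    component-is-caterpillar G (λ _ _ cycle → cycle⇒¬Winnable₂ G cycle win)
                               (λ spider → spider⇒¬Winnable₂ G spider win)

  Winnable₁⇒noEdges : Winnable G 1 → NoEdges G
  Winnable₁⇒noEdges win = [ (λ edge → ⊥-elim (edge⇒¬Winnable₁ G edge win)) , id ]′ (edge-or-noEdges G)

  ¬Winnable₁⇒hasEdge : ¬ Winnable G 1 → HasEdge G
  ¬Winnable₁⇒hasEdge lose =
    [ id , (λ no-edges → ⊥-elim (lose (noEdges⇒Winnable₁ no-edges))) ]′ (edge-or-noEdges G)

proposition1 : ∀ {n : ℕ} (G : Graph n) →
    (FFN≡ G 1 ⇔ NoEdges G) ×
    (FFN≡ G 2 ⇔ (HasEdge G × (∀ (v : Fin n) → ComponentIsCaterpillar G v)))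
proposition1 G =
  mk⇔ (λ (_ , win₁ , _) → Winnable₁⇒noEdges G win₁)
      (λ no-edges → s≤s z≤n , noEdges⇒Winnable₁ G no-edges , λ { (suc _) _ (s≤s ()) }) ,
  mk⇔ (λ (_ , win₂ , minimal) → ¬Winnable₁⇒hasEdge G (minimal 1 (s≤s z≤n) (s≤s (s≤s z≤n))) ,
                                 Winnable₂⇒caterpillars G win₂)
      (λ (edge , caterpillars) → s≤s z≤n , caterpillars⇒Winnable₂ G caterpillars ,
                                 λ { (suc zero) _ _ → edge⇒¬Winnable₁ G edge ; (suc (suc _)) _ (s≤s (s≤s ())) })
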